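{- Let $P\subset\mathbb R^n$ be a rational convex polyhedron, $R$ a commutative ring and $\varphi:\mathcal F_P\to R$ any map. Then there exists a polynomial $Q\in R[x_1,\ldots,x_n]$ such that $Q\,S_\varphi(P)\in R[x_1^{\pm1},\ldots,x_n^{\pm1}]$.
   Context: $\mathcal F_P$ is the set of faces of $P$. The map $\varphi$ defines $g:P\to R$ by $g(x)=\varphi(f)$ where $f$ is the face of minimal dimension containing $x$. For $a\in\mathbb Z^n$, $e^a=x_1^{a_1}\cdots x_n^{a_n}$. The weighted generating function is the formal series $S_\varphi(P)=\sum_{a\in P\cap\mathbb Z^n}g(a)e^a\in R[[x_1^{\pm1},\ldots,x_n^{\pm1}]]$. -}

module Defs where

open import Level using (Level; _⊔_)
open import Data.Bool using (Bool; true; false; if_then_else_; _∧_; T)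
open import Data.Nat using (ℕ)
open import Data.Integer as ℤ using (ℤ; +_)
open import Data.Rational as ℚ using (ℚ)
open import Data.Fin using (Fin)
open import Data.Vec using (Vec; []; _∷_; lookup; zipWith; map; foldr)
open import Data.List using (List)
import Data.List as L
open import Data.Product using (_×_; _,_; Σ; ∃)
open import Data.Vec.Properties using (≡-dec)
open import Relation.Nullary.Decidable using (⌊_⌋)
open import Relation.Binary.PropositionalEquality using (_≡_)
open import Algebra.Bundles using (CommutativeRing)
open import Data.Fin.Subset using (Subset; _∈_)

-- A rational convex polyhedron P = { x ∈ ℝⁿ : A x ≤ b } is presented by
-- an integer matrix A (m rows, n columns) and an integer vector b
-- (every rational polyhedron has such a presentation, clearing
-- denominators; m = 0 gives P = ℝⁿ).

Mat : ℕ → ℕ → Set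
Mat m n = Vec (Vec ℤ n) m

dotℤ : ∀ {n} → Vec ℤ n → Vec ℤ n → ℤ
dotℤ u v = foldr _ ℤ._+_ (+ 0) (zipWith ℤ._*_ u v)

dotℚ : ∀ {n} → Vec ℤ n → Vec ℚ n → ℚ
dotℚ u x = foldr _ ℚ._+_ ℚ.0ℚ (zipWith (λ a y → (a ℚ./ 1) ℚ.* y) u x)

inP : ∀ {m n} → Mat m n → Vec ℤ m → Vec ℤ n → Bool
inP []       []       a = true
inP (r ∷ A)  (bi ∷ b) a = (dotℤ r a ℤ.≤ᵇ bi) ∧ inP A b a

-- The faces of P are exactly the sets
--   F_I = { x ∈ P : A_i x = b_i for all i ∈ I },   I ⊆ {1..m}.
-- A face is thus represented by an index set I : Subset m, and two index
-- sets represent the same face iff the sets F_I, F_J coincide.  Since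
-- faces of a rational polyhedron are rational polyhedra, in which rational
-- points are dense, F_I = F_J as subsets of ℝⁿ iff they have the same
-- rational points; that is how equality of faces is tested here.

InFace : ∀ {m n} → Mat m n → Vec ℤ m → Subset m → Vec ℚ n → Set
InFace {m} A b I x =
  ((i : Fin m) → dotℚ (lookup A i) x ℚ.≤ (lookup b i ℚ./ 1)) ×
  ((i : Fin m) → i ∈ I → dotℚ (lookup A i) x ≡ (lookup b i ℚ./ 1))

SameFace : ∀ {m n} → Mat m n → Vec ℤ m → Subset m → Subset m → Set
SameFace A b I J =
  ∀ x → (InFace A b I x → InFace A b J x) × (InFace A b J x → InFace A b I x)

-- A map φ : 𝓕_P → R is a map on index sets that is well defined on faces.
FaceMap : ∀ {c ℓ} (R : CommutativeRing c ℓ) {m n} → Mat m n → Vec ℤ m → Set (c ⊔ ℓ)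
FaceMap R {m} A b =
  Σ (Subset m → Carrier) λ φ → ∀ I J → SameFace A b I J → φ I ≈ φ J
  where open CommutativeRing R

-- The set of inequalities tight at a point a ∈ P; the face of minimal
-- dimension containing a is F_{tight a}.
tight : ∀ {m n} → Mat m n → Vec ℤ m → Vec ℤ n → Subset m
tight A b a = zipWith (λ r bi → ⌊ dotℤ r a ℤ.≟ bi ⌋) A b

-- The weighted generating function S_φ(P) as a formal series
-- Σ_{a ∈ ℤⁿ} S(a) eᵃ, given by its coefficient function.

Scoeff : ∀ {c ℓ} (R : CommutativeRing c ℓ) {m n} (A : Mat m n) (b : Vec ℤ m) →
         FaceMap R A b → Vec ℤ n → CommutativeRing.Carrier R
Scoeff R A b (φ , _) a =
  if inP A b a then φ (tight A b a) else CommutativeRing.0# R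

-- Polynomials in R[x₁,…,xₙ]: finite lists of terms r·x^d (d ∈ ℕⁿ);
-- the polynomial is the sum of its terms.

Poly : ∀ {c ℓ} → CommutativeRing c ℓ → ℕ → Set c
Poly R n = List (Vec ℕ n × CommutativeRing.Carrier R)

polyCoeff : ∀ {c ℓ} (R : CommutativeRing c ℓ) {n} → Poly R n → Vec ℕ n →
            CommutativeRing.Carrier R
polyCoeff R Q e =
  L.foldr (λ { (d , r) s → if ⌊ ≡-dec Data.Nat._≟_ d e ⌋ then r + s else s }) 0# Q
  where open CommutativeRing R

NonZeroPoly : ∀ {c ℓ} (R : CommutativeRing c ℓ) {n} → Poly R n → Set ℓ
NonZeroPoly R {n} Q = ∃ λ (e : Vec ℕ n) → ¬' (polyCoeff R Q e ≈ 0#)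
  where
    open CommutativeRing R
    open import Relation.Nullary using () renaming (¬_ to ¬')

_−ᵥ_ : ∀ {n} → Vec ℤ n → Vec ℕ n → Vec ℤ n
c −ᵥ d = zipWith (λ ci di → ci ℤ.- (+ di)) c d

-- coefficient of eᶜ in the product Q · F of a polynomial Q with a formal
-- series F (given by its coefficient function); this is a finite sum.
mulCoeff : ∀ {c ℓ} (R : CommutativeRing c ℓ) {n} → Poly R n →
           (Vec ℤ n → CommutativeRing.Carrier R) → Vec ℤ n → CommutativeRing.Carrier R
mulCoeff R Q F c = L.foldr (λ { (d , r) s → r * F (c −ᵥ d) + s }) 0# Q
  where open CommutativeRing R

{-# OPTIONS --safe #-}

-- Call h : ℤⁿ → R tame if h a depends only on how each A_j · a compares with the
-- endpoints of an interval I_j; S_φ(P) is tame for I_j = [b_j, b_j].  Multiplying by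
-- xᵘ − xᵛ acts on coefficients as Δh(a) = h(a − u) − h(a − v), and when u <lex v a
-- product of such binomials has lex-least monomial with coefficient 1, so it is nonzero.
-- Some such product turns every tame h into a Laurent polynomial, by induction on the
-- number of coordinates that are not pivots of a fraction-free echelon family of forms
-- L_i along which h has bounded support.  If every coordinate is a pivot, the support of
-- h lies in a box.  Otherwise pick an integer w ≠ 0 orthogonal to all L_i and write
-- w = ±(v − u) with u, v ∈ ℕⁿ.  Then Δh is tame for enlarged intervals, still bounded
-- along every L_i, and vanishes wherever A_j · a lies outside the enlarged I_j for every
-- row with A_j · w ≠ 0.  Cutting along those slabs writes Δh as a sum of pieces each
-- supported in one slab; adding that row, reduced against the L_i, to the family of the
-- piece creates a new pivot.

module Submission where

open import Defs
open import Level using (Level)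
open import Data.Nat using (ℕ)
open import Data.Integer using (ℤ)
open import Data.Vec using (Vec)
open import Data.List using (List)
open import Data.List.Membership.Propositional using (_∈_)
open import Data.Product using (_×_; ∃)
open import Relation.Nullary using (¬_)
open import Algebra.Bundles using (CommutativeRing)

open import Function using (_∘_)
open import Data.Bool using (if_then_else_; _∧_)
import Data.Nat as ℕ
open import Data.Nat using (zero; suc)
import Data.Nat.Properties as ℕₚ
open import Data.Integer
  using (+_; -[1+_]; _+_; _*_; -_; _-_; _≤_; _<_; _⊓_; _⊔_; ∣_∣; 0ℤ; 1ℤ; -1ℤ; -≤+)
import Data.Integer as ℤ
import Data.Integer.Properties as ℤₚ
open import Data.Integer.Tactic.RingSolver using (solve-∀)
open import Data.Fin as Fin using (Fin; zero; suc)
import Data.Fin.Properties as Finₚ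
open import Data.Vec as Vec using ([]; _∷_; lookup)
import Data.Vec.Properties as Vecₚ
open import Data.Vec.Properties using (≡-dec)
open import Data.Vec.Functional using (Vector)
import Data.Vec.Relation.Binary.Lex.Strict as Lex
import Data.Vec.Relation.Binary.Pointwise.Inductive as Pointwise
import Data.List as List
open import Data.List using ([]; _∷_)
open import Data.List.Membership.Propositional using (_∉_)
open import Data.List.Membership.Propositional.Properties
  using (∈-map⁺; ∈-++⁺ˡ; ∈-++⁺ʳ; ∈-upTo⁺; ∈-cartesianProductWith⁺; ∈-allFin)
open import Data.List.Relation.Unary.Any using (here)
open import Data.List.Relation.Unary.All as All using (All; []; _∷_)
open import Data.Product using (Σ-syntax; _,_; proj₁; proj₂; uncurry)
open import Data.Sum using (_⊎_; inj₁; inj₂; [_,_]′)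
open import Relation.Binary.Bundles using (StrictPartialOrder)
open import Relation.Binary.Definitions using (tri<; tri≈; tri>)
open import Relation.Binary.PropositionalEquality
  using (_≡_; _≢_; _≗_; refl; sym; trans; cong; cong₂; subst; subst₂; module ≡-Reasoning)
open import Relation.Nullary using (Dec; yes; no; does; contradiction; ¬?)
open import Relation.Nullary.Decidable using (dec-true; dec-false; _×-dec_; ⌊_⌋; T?; isYes≗does)
open import Relation.Unary using (Decidable)
import Relation.Binary.Reasoning.Setoid
open import Algebra.Properties.Semiring.Sum ℤₚ.+-*-semiring
  using (sum; sum-cong-≋; sum-replicate-zero; ∑-distrib-+; *-distribˡ-sum)

-- Integer linear forms

Form : ℕ → Set
Form = Vector ℤ

infix 8 _·_

_·_ : ∀ {n} → Form n → Form n → ℤ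
f · w = sum λ k → f k * w k

toℤᵛ : ∀ {n} → Vec ℕ n → Form n
toℤᵛ u k = + lookup u k

combination : ∀ {k n} → (Fin k → ℤ) → (Fin k → Form n) → Form n
combination c F x = sum λ i → c i * F i x

module _ {n : ℕ} where

  ·-cong : {f f′ w w′ : Form n} → f ≗ f′ → w ≗ w′ → f · w ≡ f′ · w′
  ·-cong f≗f′ w≗w′ = sum-cong-≋ λ k → cong₂ _*_ (f≗f′ k) (w≗w′ k)

  ·-comm : (f w : Form n) → f · w ≡ w · f
  ·-comm f w = sum-cong-≋ λ k → ℤₚ.*-comm (f k) (w k)

  ·-zeroˡ : (w : Form n) → (λ _ → 0ℤ) · w ≡ 0ℤ
  ·-zeroˡ w = trans (sum-cong-≋ λ k → ℤₚ.*-zeroˡ (w k)) (sum-replicate-zero n)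

  ·-+ˡ : (f g w : Form n) → (λ k → f k + g k) · w ≡ f · w + g · w
  ·-+ˡ f g w = trans (sum-cong-≋ λ k → ℤₚ.*-distribʳ-+ (w k) (f k) (g k)) (∑-distrib-+ {n} _ _)

  ·-*ˡ : (x : ℤ) (f w : Form n) → (λ k → x * f k) · w ≡ x * (f · w)
  ·-*ˡ x f w = trans (sum-cong-≋ λ k → ℤₚ.*-assoc x (f k) (w k)) (sym (*-distribˡ-sum {n} x _))

  ·-negˡ : (f w : Form n) → (λ k → - f k) · w ≡ - (f · w)
  ·-negˡ f w = begin
    (λ k → - f k) · w      ≡⟨ ·-cong (λ k → sym (ℤₚ.-1*i≡-i (f k))) (λ _ → refl) ⟩
    (λ k → -1ℤ * f k) · w  ≡⟨ ·-*ˡ -1ℤ f w ⟩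
    -1ℤ * (f · w)          ≡⟨ ℤₚ.-1*i≡-i (f · w) ⟩
    - (f · w)              ∎
    where open ≡-Reasoning

  ·-subˡ : (f g w : Form n) → (λ k → f k - g k) · w ≡ f · w - g · w
  ·-subˡ f g w = trans (·-+ˡ f (λ k → - g k) w) (cong (_+_ (f · w)) (·-negˡ g w))

  ·-subʳ : (f w w′ : Form n) → f · (λ k → w k - w′ k) ≡ f · w - f · w′
  ·-subʳ f w w′ =
    trans (·-comm f (λ k → w k - w′ k)) (trans (·-subˡ w w′ f) (cong₂ _-_ (·-comm w f) (·-comm w′ f)))

combination-· : ∀ {k n} (c : Fin k → ℤ) (F : Fin k → Form n) (w : Form n) →
                combination c F · w ≡ sum λ i → c i * (F i · w)
combination-· {zero}  c F w = ·-zeroˡ w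
combination-· {suc k} c F w =
  trans (·-+ˡ (λ x → c zero * F zero x) (combination (c ∘ suc) (F ∘ suc)) w)
  (cong₂ _+_ (·-*ˡ (c zero) (F zero) w) (combination-· (c ∘ suc) (F ∘ suc) w))

δ : ∀ {n} → Fin n → Fin n → ℤ
δ zero    zero    = 1ℤ
δ zero    (suc _) = 0ℤ
δ (suc _) zero    = 0ℤ
δ (suc i) (suc j) = δ i j

δ-diag : ∀ {n} (i : Fin n) → δ i i ≡ 1ℤ
δ-diag zero    = refl
δ-diag (suc i) = δ-diag i

δ-≢ : ∀ {n} {i j : Fin n} → i ≢ j → δ i j ≡ 0ℤ
δ-≢ {i = zero}  {zero}  i≢j = contradiction refl i≢j
δ-≢ {i = zero}  {suc j} i≢j = refl
δ-≢ {i = suc i} {zero}  i≢j = refl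
δ-≢ {i = suc i} {suc j} i≢j = δ-≢ (i≢j ∘ cong suc)

δ-sym : ∀ {n} (i j : Fin n) → δ i j ≡ δ j i
δ-sym zero    zero    = refl
δ-sym zero    (suc j) = refl
δ-sym (suc i) zero    = refl
δ-sym (suc i) (suc j) = δ-sym i j

·-δ : ∀ {n} (f : Form n) j → f · δ j ≡ f j
·-δ f zero = trans
  (cong₂ _+_ (ℤₚ.*-identityʳ (f zero)) (trans (·-comm (f ∘ suc) _) (·-zeroˡ (f ∘ suc))))
  (ℤₚ.+-identityʳ (f zero))
·-δ f (suc j) =
  trans (cong₂ _+_ (ℤₚ.*-zeroʳ (f zero)) (·-δ (f ∘ suc) j)) (ℤₚ.+-identityˡ (f (suc j)))

-- Comparison with intervals

Interval : Set
Interval = ℤ × ℤ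

_⊕ᴵ_ : Interval → ℤ → Interval
(lo , hi) ⊕ᴵ s = lo + s , hi + s

_∪ᴵ_ : Interval → Interval → Interval
(lo , hi) ∪ᴵ (lo′ , hi′) = lo ⊓ lo′ , hi ⊔ hi′

Inside : Interval → ℤ → Set
Inside (lo , hi) x = lo ≤ x × x ≤ hi

Outside : Interval → ℤ → Set
Outside (lo , hi) x = x < lo ⊎ hi < x

inside? : ∀ I → Decidable (Inside I)
inside? (lo , hi) x = (lo ℤₚ.≤? x) ×-dec (x ℤₚ.≤? hi)

data Agree (I : Interval) : ℤ → ℤ → Set where
  equal : ∀ {x} → Agree I x x
  above : ∀ {x y} → proj₂ I < x → proj₂ I < y → Agree I x y
  below : ∀ {x y} → x < proj₁ I → y < proj₁ I → Agree I x y

private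
  i+k-k≡i : ∀ i k → i + k - k ≡ i
  i+k-k≡i = solve-∀

  i+k<j⇒i<j-k : ∀ {i j} k → i + k < j → i < j - k
  i+k<j⇒i<j-k {i} {j} k p = subst (_< j - k) (i+k-k≡i i k) (ℤₚ.+-monoˡ-< (- k) p)

  i<j+k⇒i-k<j : ∀ {i j} k → i < j + k → i - k < j
  i<j+k⇒i-k<j {i} {j} k p = subst (i - k <_) (i+k-k≡i j k) (ℤₚ.+-monoˡ-< (- k) p)

Agree-shift : ∀ I s {x y} → Agree (I ⊕ᴵ s) x y → Agree I (x - s) (y - s)
Agree-shift I s equal       = equal
Agree-shift I s (above p q) = above (i+k<j⇒i<j-k s p) (i+k<j⇒i<j-k s q)
Agree-shift I s (below p q) = below (i<j+k⇒i-k<j s p) (i<j+k⇒i-k<j s q)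

Agree-∪ˡ : ∀ I J {x y} → Agree (I ∪ᴵ J) x y → Agree I x y
Agree-∪ˡ I J equal       = equal
Agree-∪ˡ I J (above p q) =
  above (ℤₚ.≤-<-trans (ℤₚ.i≤i⊔j _ _) p) (ℤₚ.≤-<-trans (ℤₚ.i≤i⊔j _ _) q)
Agree-∪ˡ I J (below p q) =
  below (ℤₚ.<-≤-trans p (ℤₚ.i⊓j≤i _ _)) (ℤₚ.<-≤-trans q (ℤₚ.i⊓j≤i _ _))

Agree-∪ʳ : ∀ I J {x y} → Agree (I ∪ᴵ J) x y → Agree J x y
Agree-∪ʳ I J equal       = equal
Agree-∪ʳ I J (above p q) =
  above (ℤₚ.≤-<-trans (ℤₚ.i≤j⊔i _ _) p) (ℤₚ.≤-<-trans (ℤₚ.i≤j⊔i _ _) q)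
Agree-∪ʳ I J (below p q) =
  below (ℤₚ.<-≤-trans p (ℤₚ.i⊓j≤j _ _)) (ℤₚ.<-≤-trans q (ℤₚ.i⊓j≤j _ _))

Outside-∪⇒Agree : ∀ I s t {x} → Outside ((I ⊕ᴵ s) ∪ᴵ (I ⊕ᴵ t)) x → Agree I (x - s) (x - t)
Outside-∪⇒Agree I s t (inj₁ x<lo) = below
  (i<j+k⇒i-k<j s (ℤₚ.<-≤-trans x<lo (ℤₚ.i⊓j≤i _ _)))
  (i<j+k⇒i-k<j t (ℤₚ.<-≤-trans x<lo (ℤₚ.i⊓j≤j _ _)))
Outside-∪⇒Agree I s t (inj₂ hi<x) = above
  (i+k<j⇒i<j-k s (ℤₚ.≤-<-trans (ℤₚ.i≤i⊔j _ _) hi<x))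
  (i+k<j⇒i<j-k t (ℤₚ.≤-<-trans (ℤₚ.i≤j⊔i _ _) hi<x))

Agree-inside? : ∀ I {x y} → Agree I x y → does (inside? I x) ≡ does (inside? I y)
Agree-inside? I equal = refl
Agree-inside? I {x} {y} (above p q) = trans
  (dec-false (inside? I x) (λ (_ , x≤hi) → ℤₚ.<⇒≱ p x≤hi))
  (sym (dec-false (inside? I y) (λ (_ , y≤hi) → ℤₚ.<⇒≱ q y≤hi)))
Agree-inside? I {x} {y} (below p q) = trans
  (dec-false (inside? I x) (λ (lo≤x , _) → ℤₚ.<⇒≱ p lo≤x))
  (sym (dec-false (inside? I y) (λ (lo≤y , _) → ℤₚ.<⇒≱ q lo≤y)))

¬Inside⇒Outside : ∀ I {x} → ¬ Inside I x → Outside I x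
¬Inside⇒Outside (lo , hi) {x} ¬inside with lo ℤₚ.≤? x
... | no  lo≰x = inj₁ (ℤₚ.≰⇒> lo≰x)
... | yes lo≤x = inj₂ (ℤₚ.≰⇒> λ x≤hi → ¬inside (lo≤x , x≤hi))

private
  i≤∣i∣ : ∀ i → i ≤ + ∣ i ∣
  i≤∣i∣ (+ n)    = ℤₚ.≤-refl
  i≤∣i∣ -[1+ n ] = -≤+

Inside⇒∣∣≤ : ∀ lo hi {x} → Inside (lo , hi) x → ∣ x ∣ ℕ.≤ ∣ lo ∣ ℕ.⊔ ∣ hi ∣
Inside⇒∣∣≤ lo hi {+ k} (_ , x≤hi) =
  ℕₚ.m≤n⇒m≤o⊔n ∣ lo ∣ (ℤₚ.drop‿+≤+ (ℤₚ.≤-trans x≤hi (i≤∣i∣ hi)))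
Inside⇒∣∣≤ lo hi { -[1+ k ]} (lo≤x , _) =
  ℕₚ.m≤n⇒m≤n⊔o ∣ hi ∣ (ℤₚ.drop‿+≤+ (ℤₚ.≤-trans (ℤₚ.neg-mono-≤ lo≤x)
    (subst (λ z → - lo ≤ + z) (ℤₚ.∣-i∣≡∣i∣ lo) (i≤∣i∣ (- lo)))))

+∣j∣<∣i∣⇒<∣i-j∣ : ∀ B i j → B ℕ.+ ∣ j ∣ ℕ.< ∣ i ∣ → B ℕ.< ∣ i - j ∣
+∣j∣<∣i∣⇒<∣i-j∣ B i j lt = ℕₚ.+-cancelʳ-< (∣ j ∣) B (∣ i - j ∣) (ℕₚ.<-≤-trans lt triangle)
  where
    i-j+j≡i : ∀ i j → i - j + j ≡ i
    i-j+j≡i = solve-∀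
    triangle : ∣ i ∣ ℕ.≤ ∣ i - j ∣ ℕ.+ ∣ j ∣
    triangle = subst (λ z → ∣ z ∣ ℕ.≤ ∣ i - j ∣ ℕ.+ ∣ j ∣) (i-j+j≡i i j)
                 (ℤₚ.∣i+j∣≤∣i∣+∣j∣ (i - j) j)

-- Lexicographic order and exponent vectors

infix 4 _<ˡᵉˣ_

_<ˡᵉˣ_ : ∀ {n} → Vec ℕ n → Vec ℕ n → Set
_<ˡᵉˣ_ = Lex.Lex-< _≡_ ℕ._<_

module <ˡᵉˣ {n} = StrictPartialOrder (Lex.<-strictPartialOrder ℕₚ.<-strictPartialOrder n)

<ˡᵉˣ⇒≢ : ∀ {n} {d e : Vec ℕ n} → d <ˡᵉˣ e → d ≢ e
<ˡᵉˣ⇒≢ d<d refl = <ˡᵉˣ.irrefl (Pointwise.refl refl) d<d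

_+ᴺ_ : ∀ {n} → Vec ℕ n → Vec ℕ n → Vec ℕ n
_+ᴺ_ = Vec.zipWith ℕ._+_

+ᴺ-monoˡ-<ˡᵉˣ : ∀ {n} {d e : Vec ℕ n} u → d <ˡᵉˣ e → d +ᴺ u <ˡᵉˣ e +ᴺ u
+ᴺ-monoˡ-<ˡᵉˣ []       (Lex.base ())
+ᴺ-monoˡ-<ˡᵉˣ (u ∷ us) (Lex.this d<e refl)  = Lex.this (ℕₚ.+-monoˡ-< u d<e) refl
+ᴺ-monoˡ-<ˡᵉˣ (u ∷ us) (Lex.next refl ds<es) = Lex.next refl (+ᴺ-monoˡ-<ˡᵉˣ us ds<es)

+ᴺ-monoʳ-<ˡᵉˣ : ∀ {n} {u v : Vec ℕ n} d → u <ˡᵉˣ v → d +ᴺ u <ˡᵉˣ d +ᴺ v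
+ᴺ-monoʳ-<ˡᵉˣ []       (Lex.base ())
+ᴺ-monoʳ-<ˡᵉˣ (d ∷ ds) (Lex.this u<v refl)  = Lex.this (ℕₚ.+-monoʳ-< d u<v) refl
+ᴺ-monoʳ-<ˡᵉˣ (d ∷ ds) (Lex.next refl us<vs) = Lex.next refl (+ᴺ-monoʳ-<ˡᵉˣ ds us<vs)

_+ᵥ_ : ∀ {n} → Vec ℤ n → Vec ℕ n → Vec ℤ n
c +ᵥ d = Vec.zipWith (λ cᵢ dᵢ → cᵢ + + dᵢ) c d

−ᵥ-comm : ∀ {n} (c : Vec ℤ n) x y → (c −ᵥ x) −ᵥ y ≡ (c −ᵥ y) −ᵥ x
−ᵥ-comm []       []       []       = refl
−ᵥ-comm (c ∷ cs) (x ∷ xs) (y ∷ ys) = cong₂ _∷_ (a-b-c≡a-c-b c (+ x) (+ y)) (−ᵥ-comm cs xs ys)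
  where
    a-b-c≡a-c-b : ∀ a b c → a - b - c ≡ a - c - b
    a-b-c≡a-c-b = solve-∀

−ᵥ-+ᴺ : ∀ {n} (c : Vec ℤ n) d u → c −ᵥ (d +ᴺ u) ≡ (c −ᵥ d) −ᵥ u
−ᵥ-+ᴺ []       []       []       = refl
−ᵥ-+ᴺ (c ∷ cs) (d ∷ ds) (u ∷ us) =
  cong₂ _∷_ (trans (cong (_-_ c) (ℤₚ.pos-+ d u)) (a-[b+c]≡a-b-c c (+ d) (+ u))) (−ᵥ-+ᴺ cs ds us)
  where
    a-[b+c]≡a-b-c : ∀ a b c → a - (b + c) ≡ a - b - c
    a-[b+c]≡a-b-c = solve-∀

−ᵥ-+ᵥ : ∀ {n} (e : Vec ℤ n) u → (e −ᵥ u) +ᵥ u ≡ e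
−ᵥ-+ᵥ []       []       = refl
−ᵥ-+ᵥ (e ∷ es) (u ∷ us) = cong₂ _∷_ (a-b+b≡a e (+ u)) (−ᵥ-+ᵥ es us)
  where
    a-b+b≡a : ∀ a b → a - b + b ≡ a
    a-b+b≡a = solve-∀

−ᵥ-zero : ∀ {n} (c : Vec ℤ n) → c −ᵥ Vec.replicate n 0 ≡ c
−ᵥ-zero []       = refl
−ᵥ-zero (c ∷ cs) = cong₂ _∷_ (ℤₚ.+-identityʳ c) (−ᵥ-zero cs)

·-−ᵥ : ∀ {n} (f : Form n) a u → f · lookup (a −ᵥ u) ≡ f · lookup a - f · toℤᵛ u
·-−ᵥ f a u = trans (·-cong {f = f} (λ _ → refl) lookup-−ᵥ) (·-subʳ f (lookup a) (toℤᵛ u))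
  where
    lookup-−ᵥ : ∀ k → lookup (a −ᵥ u) k ≡ lookup a k - toℤᵛ u k
    lookup-−ᵥ k = Vecₚ.lookup-zipWith (λ aᵢ uᵢ → aᵢ - + uᵢ) k a u

Binomial : ℕ → Set
Binomial n = Vec ℕ n × Vec ℕ n

Ordered : ∀ {n} → Binomial n → Set
Ordered (u , v) = u <ˡᵉˣ v

private
  positivePart negativePart : ℤ → ℕ
  positivePart (+ k)    = k
  positivePart -[1+ k ] = 0
  negativePart (+ k)    = 0
  negativePart -[1+ k ] = suc k

  positive-negative : ∀ z → + positivePart z - + negativePart z ≡ z
  positive-negative (+ k)    = ℤₚ.+-identityʳ (+ k)
  positive-negative -[1+ k ] = refl

  positive≡negative⇒0 : ∀ z → positivePart z ≡ negativePart z → z ≡ 0ℤ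
  positive≡negative⇒0 (+ k)    k≡0 = cong +_ k≡0
  positive≡negative⇒0 -[1+ k ] ()

  positiveParts negativeParts : ∀ {n} → Form n → Vec ℕ n
  positiveParts w = Vec.tabulate (positivePart ∘ w)
  negativeParts w = Vec.tabulate (negativePart ∘ w)

  parts-balanced : ∀ {n} (w f : Form n) → f · w ≡ 0ℤ →
                   f · toℤᵛ (positiveParts w) ≡ f · toℤᵛ (negativeParts w)
  parts-balanced w f f·w≡0 = ℤₚ.i-j≡0⇒i≡j _ _ (begin
    f · toℤᵛ pos - f · toℤᵛ neg            ≡⟨ ·-subʳ f (toℤᵛ pos) (toℤᵛ neg) ⟨
    f · (λ k → toℤᵛ pos k - toℤᵛ neg k)  ≡⟨ ·-cong {f = f} (λ _ → refl) split ⟩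
    f · w                                  ≡⟨ f·w≡0 ⟩
    0ℤ                                     ∎)
    where
      open ≡-Reasoning
      pos = positiveParts w
      neg = negativeParts w
      split : ∀ k → toℤᵛ pos k - toℤᵛ neg k ≡ w k
      split k = trans
        (cong₂ (λ a b → + a - + b) (Vecₚ.lookup∘tabulate _ k) (Vecₚ.lookup∘tabulate _ k))
        (positive-negative (w k))

orient : ∀ {n} (w : Form n) col → w col ≢ 0ℤ →
         Σ[ p ∈ Binomial n ] Ordered p ×
           (∀ f → f · w ≡ 0ℤ → f · toℤᵛ (proj₁ p) ≡ f · toℤᵛ (proj₂ p))
orient w col w≢0 with Lex.<-cmp sym ℕₚ.<-cmp (negativeParts w) (positiveParts w)
... | tri< neg<pos _ _ = _ , neg<pos , λ f f·w≡0 → sym (parts-balanced w f f·w≡0)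
... | tri> _ _ pos<neg = _ , pos<neg , parts-balanced w
... | tri≈ _ neg≈pos _ = contradiction (positive≡negative⇒0 (w col) (begin
  positivePart (w col)             ≡⟨ Vecₚ.lookup∘tabulate (positivePart ∘ w) col ⟨
  lookup (positiveParts w) col     ≡⟨ cong (λ z → lookup z col) (Pointwise.Pointwise-≡⇒≡ neg≈pos) ⟨
  lookup (negativeParts w) col     ≡⟨ Vecₚ.lookup∘tabulate (negativePart ∘ w) col ⟩
  negativePart (w col)             ∎)) w≢0
  where open ≡-Reasoning

-- Lattice boxes

range : ℕ → List ℤ
range B = List.map +_ (List.upTo (suc B)) List.++ List.map -[1+_] (List.upTo B)

∈-range : ∀ {B} z → ∣ z ∣ ℕ.≤ B → z ∈ range B
∈-range {B} (+ k)    k≤B = ∈-++⁺ˡ (∈-map⁺ +_ (∈-upTo⁺ (ℕ.s≤s k≤B)))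
∈-range {B} -[1+ k ] k<B = ∈-++⁺ʳ (List.map +_ (List.upTo (suc B))) (∈-map⁺ -[1+_] (∈-upTo⁺ k<B))

box : ∀ {n} → (Fin n → ℕ) → List (Vec ℤ n)
box {zero}  B = List.[ [] ]
box {suc n} B = List.cartesianProductWith _∷_ (range (B zero)) (box (B ∘ suc))

∈-box : ∀ {n} {B : Fin n → ℕ} (a : Vec ℤ n) → (∀ k → ∣ lookup a k ∣ ℕ.≤ B k) → a ∈ box B
∈-box []      bounded = here refl
∈-box (x ∷ a) bounded =
  ∈-cartesianProductWith⁺ _∷_ (∈-range x (bounded zero)) (∈-box a (bounded ∘ suc))

∉-box : ∀ {n} {B : Fin n → ℕ} (a : Vec ℤ n) → a ∉ box B → ∃ λ k → B k ℕ.< ∣ lookup a k ∣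
∉-box {n} {B} a a∉box with Finₚ.¬∀⟶∃¬ n _ (λ k → ∣ lookup a k ∣ ℕ.≤? B k) (a∉box ∘ ∈-box a)
... | k , ¬bounded = k , ℕₚ.≰⇒> ¬bounded

-- Fraction-free echelon families of forms

record IsSubmodule {n p} (P : Form n → Set p) : Set p where
  field
    0-closed   : P (λ _ → 0ℤ)
    +-closed   : ∀ {f g} → P f → P g → P (λ x → f x + g x)
    *-closed   : ∀ c {f} → P f → P (λ x → c * f x)
    neg-closed : ∀ {f} → P f → P (λ x → - f x)

  combination-closed : ∀ {k} c {F : Fin k → Form n} → (∀ i → P (F i)) → P (combination c F)
  combination-closed {zero}  c PF = 0-closed
  combination-closed {suc k} c PF =
    +-closed (*-closed (c zero) (PF zero)) (combination-closed (c ∘ suc) (PF ∘ suc))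

injective-avoiding⇒< : ∀ {k n} {f : Fin k → Fin n} {c : Fin n} →
                       (∀ {i j} → f i ≡ f j → i ≡ j) → (∀ i → f i ≢ c) → k ℕ.< n
injective-avoiding⇒< {n = suc n} {f} {c} f-injective avoids =
  ℕ.s≤s (Finₚ.injective⇒≤ {f = λ i → Fin.punchOut (avoids i ∘ sym)} punched-injective)
  where
    punched-injective : ∀ {i j} → Fin.punchOut (avoids i ∘ sym) ≡ Fin.punchOut (avoids j ∘ sym) → i ≡ j
    punched-injective eq = f-injective (Finₚ.punchOut-injective (avoids _ ∘ sym) (avoids _ ∘ sym) eq)

record Echelon (n k : ℕ) : Set where
  field
    D          : ℤ
    D≢0        : D ≢ 0ℤ
    pivot      : Fin k → Fin n
    form       : Fin k → Form n
    form-pivot : ∀ i j → form i (pivot j) ≡ D * δ i j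

module _ {n k} (E : Echelon n k) where
  open Echelon E

  Free : Fin n → Set
  Free col = ∀ i → pivot i ≢ col

  form-pivot-diag : ∀ i → form i (pivot i) ≡ D
  form-pivot-diag i = trans (form-pivot i i) (trans (cong (D *_) (δ-diag i)) (ℤₚ.*-identityʳ D))

  form-pivot-≢ : ∀ {i j} → i ≢ j → form i (pivot j) ≡ 0ℤ
  form-pivot-≢ {i} {j} i≢j = trans (form-pivot i j) (trans (cong (D *_) (δ-≢ i≢j)) (ℤₚ.*-zeroʳ D))

  pivot-injective : ∀ {i j} → pivot i ≡ pivot j → i ≡ j
  pivot-injective {i} {j} eq with i Fin.≟ j
  ... | yes i≡j = i≡j
  ... | no  i≢j = contradiction
    (trans (sym (form-pivot-diag i)) (trans (cong (form i) eq) (form-pivot-≢ i≢j))) D≢0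

  pivot? : ∀ col → Dec (∃ λ i → pivot i ≡ col)
  pivot? col = Finₚ.any? λ i → pivot i Fin.≟ col

  surjective⊎free : (∀ col → ∃ λ i → pivot i ≡ col) ⊎ ∃ Free
  surjective⊎free with Finₚ.all? pivot?
  ... | yes onto = inj₁ onto
  ... | no ¬onto with Finₚ.¬∀⟶∃¬ n _ pivot? ¬onto
  ...   | col , ¬pivot = inj₂ (col , λ i eq → ¬pivot (i , eq))

  pivot-surjective : k ≡ n → ∀ col → ∃ λ i → pivot i ≡ col
  pivot-surjective k≡n with surjective⊎free
  ... | inj₁ onto          = onto
  ... | inj₂ (col , free) =
    contradiction (subst (ℕ._< n) k≡n (injective-avoiding⇒< pivot-injective free)) (ℕₚ.<-irrefl refl)

  ∣pivot-coordinate∣≤ : (∀ col → ∃ λ i → pivot i ≡ col) →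
                        ∀ i (a : Form n) → ∣ a (pivot i) ∣ ℕ.≤ ∣ form i · a ∣
  ∣pivot-coordinate∣≤ onto i a = begin
    ∣ a (pivot i) ∣               ≤⟨ ℕₚ.m≤n*m _ ∣ D ∣ ⦃ ℕ.≢-nonZero (D≢0 ∘ ℤₚ.∣i∣≡0⇒i≡0) ⦄ ⟩
    ∣ D ∣ ℕ.* ∣ a (pivot i) ∣     ≡⟨ ℤₚ.abs-* D (a (pivot i)) ⟨
    ∣ D * a (pivot i) ∣           ≡⟨ cong ∣_∣ form·a ⟨
    ∣ form i · a ∣                ∎
    where
      open ℕₚ.≤-Reasoning
      δ-pivot : ∀ j → δ i j ≡ δ (pivot i) (pivot j)
      δ-pivot j with i Fin.≟ j
      ... | yes refl = trans (δ-diag i) (sym (δ-diag (pivot i)))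
      ... | no  i≢j  = trans (δ-≢ i≢j) (sym (δ-≢ (i≢j ∘ pivot-injective)))
      form-onto : ∀ x → form i x ≡ D * δ (pivot i) x
      form-onto x with onto x
      ... | j , refl = trans (form-pivot i j) (cong (D *_) (δ-pivot j))
      form·a : form i · a ≡ D * a (pivot i)
      form·a = trans (·-cong form-onto (λ _ → refl)) (trans (·-*ˡ D (δ (pivot i)) a)
                 (cong (D *_) (trans (·-comm (δ (pivot i)) a) (·-δ a (pivot i)))))

  kernel : Fin n → Form n
  kernel col x = D * δ col x - combination (λ i → form i col) (λ i → δ (pivot i)) x

  kernel-orthogonal : ∀ col q → form q · kernel col ≡ 0ℤ
  kernel-orthogonal col q = begin
    form q · kernel col                                   ≡⟨ ·-subʳ (form q) _ _ ⟩
    form q · (λ x → D * δ col x) - form q · combination c e ≡⟨ cong₂ _-_ D-part combination-part ⟩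
    D * form q col - D * form q col                       ≡⟨ ℤₚ.+-inverseʳ (D * form q col) ⟩
    0ℤ                                                    ∎
    where
      open ≡-Reasoning
      c = λ i → form i col
      e = λ i → δ (pivot i)
      D-part : form q · (λ x → D * δ col x) ≡ D * form q col
      D-part = trans (·-comm (form q) _) (trans (·-*ˡ D (δ col) (form q))
                 (cong (D *_) (trans (·-comm (δ col) (form q)) (·-δ (form q) col))))
      combination-part : form q · combination c e ≡ D * form q col
      combination-part = begin
        form q · combination c e                   ≡⟨ ·-comm (form q) _ ⟩
        combination c e · form q                   ≡⟨ combination-· c e (form q) ⟩
        sum (λ i → c i * (e i · form q))           ≡⟨ sum-cong-≋ (λ i → cong (c i *_)
                                                        (trans (·-comm (e i) (form q)) (·-δ (form q) (pivot i)))) ⟩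
        sum (λ i → c i * form q (pivot i))         ≡⟨ sum-cong-≋ (λ i → trans (cong (c i *_) (form-pivot q i))
                                                        (reassoc (c i) D (δ q i))) ⟩
        (λ i → D * c i) · δ q                      ≡⟨ ·-δ (λ i → D * c i) q ⟩
        D * form q col                             ∎
        where
          reassoc : ∀ a b c → a * (b * c) ≡ b * a * c
          reassoc = solve-∀

  kernel-free : ∀ {col} → Free col → kernel col col ≡ D
  kernel-free {col} free = trans
    (cong₂ _-_ (trans (cong (D *_) (δ-diag col)) (ℤₚ.*-identityʳ D)) off-pivots)
    (ℤₚ.+-identityʳ D)
    where
      off-pivots : combination (λ i → form i col) (λ i → δ (pivot i)) col ≡ 0ℤ
      off-pivots = trans
        (sum-cong-≋ λ i → trans (cong (form i col *_) (δ-≢ (free i))) (ℤₚ.*-zeroʳ (form i col)))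
        (sum-replicate-zero k)

module _ {n k} (E : Echelon n k) (a₀ : Form n) where
  open Echelon E

  residual : Form n
  residual x = D * a₀ x - combination (a₀ ∘ pivot) form x

  residual-pivot : ∀ q → residual (pivot q) ≡ 0ℤ
  residual-pivot q = trans (cong (_-_ (D * a₀ (pivot q))) eliminated) (ℤₚ.+-inverseʳ (D * a₀ (pivot q)))
    where
      reassoc : ∀ a b c → a * (b * c) ≡ b * a * c
      reassoc = solve-∀
      eliminated : combination (a₀ ∘ pivot) form (pivot q) ≡ D * a₀ (pivot q)
      eliminated = trans
        (sum-cong-≋ λ i → trans (cong (a₀ (pivot i) *_) (trans (form-pivot i q) (cong (D *_) (δ-sym i q))))
                                (reassoc (a₀ (pivot i)) D (δ q i)))
        (·-δ (λ i → D * a₀ (pivot i)) q)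

  residual-· : ∀ w → (∀ i → form i · w ≡ 0ℤ) → residual · w ≡ D * (a₀ · w)
  residual-· w w⊥form = begin
    residual · w
      ≡⟨ ·-subˡ (λ x → D * a₀ x) (combination (a₀ ∘ pivot) form) w ⟩
    (λ x → D * a₀ x) · w - combination (a₀ ∘ pivot) form · w
      ≡⟨ cong₂ _-_ (·-*ˡ D a₀ w) (combination-· (a₀ ∘ pivot) form w) ⟩
    D * (a₀ · w) - sum (λ i → a₀ (pivot i) * (form i · w))       ≡⟨ cong (_-_ (D * (a₀ · w))) orthogonal ⟩
    D * (a₀ · w) - 0ℤ                                            ≡⟨ ℤₚ.+-identityʳ _ ⟩
    D * (a₀ · w)                                                 ∎
    where
      open ≡-Reasoning
      orthogonal : sum (λ i → a₀ (pivot i) * (form i · w)) ≡ 0ℤ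
      orthogonal = trans
        (sum-cong-≋ λ i → trans (cong (a₀ (pivot i) *_) (w⊥form i)) (ℤₚ.*-zeroʳ (a₀ (pivot i))))
        (sum-replicate-zero k)

  residual-closed : ∀ {p} {P : Form n → Set p} → IsSubmodule P → P a₀ → (∀ i → P (form i)) →
                    P residual
  residual-closed P-sub Pa₀ Pform =
    +-closed (*-closed D Pa₀) (neg-closed (combination-closed (a₀ ∘ pivot) Pform))
    where open IsSubmodule P-sub

  module _ (w : Form n) (w⊥form : ∀ i → form i · w ≡ 0ℤ) (a₀·w≢0 : a₀ · w ≢ 0ℤ) where

    residual≢0 : ∃ λ col → residual col ≢ 0ℤ
    residual≢0 with Finₚ.all? (λ x → residual x ℤₚ.≟ 0ℤ)
    ... | no ¬zero = Finₚ.¬∀⟶∃¬ n _ (λ x → residual x ℤₚ.≟ 0ℤ) ¬zero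
    ... | yes vanishes with ℤₚ.i*j≡0⇒i≡0∨j≡0 D
      (trans (sym (residual-· w w⊥form)) (trans (·-cong vanishes (λ _ → refl)) (·-zeroˡ w)))
    ...   | inj₁ D≡0   = contradiction D≡0 D≢0
    ...   | inj₂ a₀·w≡0 = contradiction a₀·w≡0 a₀·w≢0

    private
      col₂ = proj₁ residual≢0
      ρ    = residual col₂

    extend : Echelon n (suc k)
    extend = record
      { D          = D * ρ
      ; D≢0        = [ D≢0 , proj₂ residual≢0 ]′ ∘ ℤₚ.i*j≡0⇒i≡0∨j≡0 D
      ; pivot      = pivot′
      ; form       = form′
      ; form-pivot = form′-pivot′
      }
      where
        pivot′ : Fin (suc k) → Fin n
        pivot′ zero    = col₂
        pivot′ (suc i) = pivot i

        form′ : Fin (suc k) → Form n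
        form′ zero    x = D * residual x
        form′ (suc i) x = ρ * form i x - form i col₂ * residual x

        form′-pivot′ : ∀ i j → form′ i (pivot′ j) ≡ D * ρ * δ i j
        form′-pivot′ zero    zero    = sym (ℤₚ.*-identityʳ (D * ρ))
        form′-pivot′ zero    (suc q) = trans (cong (D *_) (residual-pivot q))
                                         (trans (ℤₚ.*-zeroʳ D) (sym (ℤₚ.*-zeroʳ (D * ρ))))
        form′-pivot′ (suc i) zero    = cancel ρ (form i col₂) D
          where
            cancel : ∀ r f d → r * f - f * r ≡ d * r * 0ℤ
            cancel = solve-∀
        form′-pivot′ (suc i) (suc q) = trans
          (cong₂ (λ a b → ρ * a - form i col₂ * b) (form-pivot i q) (residual-pivot q))
          (rescale ρ D (δ i q) (form i col₂))
          where
            rescale : ∀ r d t f → r * (d * t) - f * 0ℤ ≡ d * r * t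
            rescale = solve-∀

    extend-closed : ∀ {p} {P : Form n → Set p} → IsSubmodule P → P a₀ → (∀ i → P (form i)) →
                    ∀ i → P (Echelon.form extend i)
    extend-closed P-sub Pa₀ Pform zero    = *-closed D (residual-closed P-sub Pa₀ Pform)
      where open IsSubmodule P-sub
    extend-closed P-sub Pa₀ Pform (suc i) =
      +-closed (*-closed ρ (Pform i)) (neg-closed (*-closed (form i col₂) (residual-closed P-sub Pa₀ Pform)))
      where open IsSubmodule P-sub

-- Series on ℤⁿ and binomial products

module Series {c ℓ} (R : CommutativeRing c ℓ) (n : ℕ) where
  open CommutativeRing R
    using (Carrier; _≈_; setoid; +-cong; -‿cong; 0#; 1#; -‿inverseʳ;
           +-identityʳ; +-identityˡ; *-identityˡ; +-assoc)
    renaming (refl to ≈-refl; sym to ≈-sym; trans to ≈-trans;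
              _+_ to _⊕_; _*_ to _⊛_; _-_ to _⊝_; -_ to ⊖_)
  module ≈-Reasoning = Relation.Binary.Reasoning.Setoid setoid
  import Algebra.Properties.Ring (CommutativeRing.ring R) as Ringₚ
  open import Algebra.Solver.Ring.AlmostCommutativeRing
    using (AlmostCommutativeRing; fromCommutativeRing; -raw-almostCommutative⟶)
  open import Data.Maybe using (nothing)
  open import Data.List.Relation.Unary.All.Properties using (++⁺)

  private
    R′ : AlmostCommutativeRing c ℓ
    R′ = fromCommutativeRing R
  open import Algebra.Solver.Ring (AlmostCommutativeRing.rawRing R′) R′
    (-raw-almostCommutative⟶ R′) (λ _ _ → nothing)
    using (solve; _:+_; _:-_; _:=_)

  Series : Set c
  Series = Vec ℤ n → Carrier

  infix 4 _≐_
  _≐_ : Series → Series → Set ℓ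
  f ≐ g = ∀ a → f a ≈ g a

  Δ : Binomial n → Series → Series
  Δ (u , v) f a = f (a −ᵥ u) ⊝ f (a −ᵥ v)

  Δ* : List (Binomial n) → Series → Series
  Δ* []      f = f
  Δ* (p ∷ W) f = Δ* W (Δ p f)

  Δ-cong : ∀ p {f g} → f ≐ g → Δ p f ≐ Δ p g
  Δ-cong (u , v) f≐g a = +-cong (f≐g (a −ᵥ u)) (-‿cong (f≐g (a −ᵥ v)))

  Δ*-cong : ∀ W {f g} → f ≐ g → Δ* W f ≐ Δ* W g
  Δ*-cong []      f≐g = f≐g
  Δ*-cong (p ∷ W) f≐g = Δ*-cong W (Δ-cong p f≐g)

  Δ-+ : ∀ p f g → Δ p (λ a → f a ⊕ g a) ≐ λ a → Δ p f a ⊕ Δ p g a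
  Δ-+ (u , v) f g a = solve 4 (λ x y x′ y′ → (x :+ y) :- (x′ :+ y′) := (x :- x′) :+ (y :- y′)) ≈-refl
    (f (a −ᵥ u)) (g (a −ᵥ u)) (f (a −ᵥ v)) (g (a −ᵥ v))

  Δ*-+ : ∀ W f g → Δ* W (λ a → f a ⊕ g a) ≐ λ a → Δ* W f a ⊕ Δ* W g a
  Δ*-+ []      f g a = ≈-refl
  Δ*-+ (p ∷ W) f g a = ≈-trans (Δ*-cong W (Δ-+ p f g) a) (Δ*-+ W (Δ p f) (Δ p g) a)

  Δ-comm : ∀ p q f → Δ p (Δ q f) ≐ Δ q (Δ p f)
  Δ-comm (u , v) (u′ , v′) f a
    rewrite −ᵥ-comm a u u′ | −ᵥ-comm a u v′ | −ᵥ-comm a v u′ | −ᵥ-comm a v v′ =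
    solve 4 (λ x y x′ y′ → (x :- y) :- (x′ :- y′) := (x :- x′) :- (y :- y′)) ≈-refl _ _ _ _

  Δ*-Δ : ∀ W p f → Δ* W (Δ p f) ≐ Δ p (Δ* W f)
  Δ*-Δ []      p f a = ≈-refl
  Δ*-Δ (q ∷ W) p f a = ≈-trans (Δ*-cong W (Δ-comm q p f) a) (Δ*-Δ W p (Δ q f) a)

  Δ*-comm : ∀ W V f → Δ* W (Δ* V f) ≐ Δ* V (Δ* W f)
  Δ*-comm W []      f a = ≈-refl
  Δ*-comm W (q ∷ V) f a = ≈-trans (Δ*-comm W V (Δ q f) a) (Δ*-cong V (Δ*-Δ W q f) a)

  Δ*-++ : ∀ W V f → Δ* (W List.++ V) f ≐ Δ* V (Δ* W f)
  Δ*-++ []      V f a = ≈-refl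
  Δ*-++ (p ∷ W) V f a = Δ*-++ W V (Δ p f) a

  FiniteSupport : List (Vec ℤ n) → Series → Set ℓ
  FiniteSupport L f = ∀ a → a ∉ L → f a ≈ 0#

  shift : Binomial n → List (Vec ℤ n) → List (Vec ℤ n)
  shift (u , v) L = List.map (_+ᵥ u) L List.++ List.map (_+ᵥ v) L

  shift* : List (Binomial n) → List (Vec ℤ n) → List (Vec ℤ n)
  shift* []      L = L
  shift* (p ∷ W) L = shift* W (shift p L)

  FiniteSupport-Δ : ∀ p {L f} → FiniteSupport L f → FiniteSupport (shift p L) (Δ p f)
  FiniteSupport-Δ (u , v) {L} {f} support a a∉ = begin
    f (a −ᵥ u) ⊝ f (a −ᵥ v)  ≈⟨ +-cong (support _ a-u∉) (-‿cong (support _ a-v∉)) ⟩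
    0# ⊝ 0#                  ≈⟨ -‿inverseʳ 0# ⟩
    0#                       ∎
    where
      open ≈-Reasoning
      a-u∉ : a −ᵥ u ∉ L
      a-u∉ a-u∈ = a∉ (∈-++⁺ˡ (subst (_∈ List.map (_+ᵥ u) L) (−ᵥ-+ᵥ a u) (∈-map⁺ (_+ᵥ u) a-u∈)))
      a-v∉ : a −ᵥ v ∉ L
      a-v∉ a-v∈ = a∉ (∈-++⁺ʳ (List.map (_+ᵥ u) L)
                       (subst (_∈ List.map (_+ᵥ v) L) (−ᵥ-+ᵥ a v) (∈-map⁺ (_+ᵥ v) a-v∈)))

  FiniteSupport-Δ* : ∀ W {L f} → FiniteSupport L f → FiniteSupport (shift* W L) (Δ* W f)
  FiniteSupport-Δ* []      support = support
  FiniteSupport-Δ* (p ∷ W) support = FiniteSupport-Δ* W (FiniteSupport-Δ p support)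

  -- Multiplying f by the product of the binomials xᵘ − xᵛ in W yields a Laurent polynomial.
  Finitizable : Series → Set ℓ
  Finitizable f =
    Σ[ W ∈ List (Binomial n) ] All Ordered W × Σ[ L ∈ List (Vec ℤ n) ] FiniteSupport L (Δ* W f)

  finitizable-cong : ∀ {f g} → f ≐ g → Finitizable f → Finitizable g
  finitizable-cong f≐g (W , ordered , L , support) =
    W , ordered , L , λ a a∉ → ≈-trans (≈-sym (Δ*-cong W f≐g a)) (support a a∉)

  finitizable-Δ : ∀ {p f} → Ordered p → Finitizable (Δ p f) → Finitizable f
  finitizable-Δ {p} ordered (W , ordereds , L , support) = p ∷ W , ordered ∷ ordereds , L , support

  finitizable-+ : ∀ {f g} → Finitizable f → Finitizable g → Finitizable (λ a → f a ⊕ g a)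
  finitizable-+ {f} {g} (W , ordered-W , L , support-f) (V , ordered-V , K , support-g) =
    W List.++ V , ++⁺ ordered-W ordered-V , shift* V L List.++ shift* W K , support
    where
      support : FiniteSupport (shift* V L List.++ shift* W K) (Δ* (W List.++ V) (λ a → f a ⊕ g a))
      support a a∉ = begin
        Δ* (W List.++ V) (λ a → f a ⊕ g a) a      ≈⟨ Δ*-++ W V _ a ⟩
        Δ* V (Δ* W (λ a → f a ⊕ g a)) a           ≈⟨ Δ*-cong V (Δ*-+ W f g) a ⟩
        Δ* V (λ a → Δ* W f a ⊕ Δ* W g a) a        ≈⟨ Δ*-+ V (Δ* W f) (Δ* W g) a ⟩
        Δ* V (Δ* W f) a ⊕ Δ* V (Δ* W g) a         ≈⟨ +-cong ≈-refl (Δ*-comm V W g a) ⟩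
        Δ* V (Δ* W f) a ⊕ Δ* W (Δ* V g) a         ≈⟨ +-cong (FiniteSupport-Δ* V support-f a (a∉ ∘ ∈-++⁺ˡ))
                                                            (FiniteSupport-Δ* W support-g a (a∉ ∘ ∈-++⁺ʳ _)) ⟩
        0# ⊕ 0#                                   ≈⟨ +-identityʳ 0# ⟩
        0#                                        ∎
        where open ≈-Reasoning

  finitizable-box : ∀ {f} (B : Fin n → ℕ) → (∀ a k → B k ℕ.< ∣ lookup a k ∣ → f a ≈ 0#) →
                    Finitizable f
  finitizable-box B vanishes =
    [] , [] , box B , λ a a∉ → let k , B<∣aₖ∣ = ∉-box a a∉ in vanishes a k B<∣aₖ∣

  BoundedAlong : Series → Form n → Set ℓ
  BoundedAlong h f = ∃ λ B → ∀ a → B ℕ.< ∣ f · lookup a ∣ → h a ≈ 0#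

  BoundedAlong-isSubmodule : ∀ h → IsSubmodule (BoundedAlong h)
  BoundedAlong-isSubmodule h = record
    { 0-closed   = 0 , λ a 0<∣0·a∣ →
        contradiction (subst (λ z → 0 ℕ.< ∣ z ∣) (·-zeroˡ (lookup a)) 0<∣0·a∣) (ℕₚ.<-irrefl refl)
    ; +-closed   = λ {f} {g} → +-closed {f} {g}
    ; *-closed   = *-closed
    ; neg-closed = λ {f} (B , bounded) → B , λ a lt →
        bounded a (subst (B ℕ.<_)
          (trans (cong ∣_∣ (·-negˡ f (lookup a))) (ℤₚ.∣-i∣≡∣i∣ (f · lookup a))) lt)
    }
    where
      +-closed : ∀ {f g} → BoundedAlong h f → BoundedAlong h g → BoundedAlong h (λ x → f x + g x)
      +-closed {f} {g} (B₁ , bounded₁) (B₂ , bounded₂) = B₁ ℕ.+ B₂ , vanish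
        where
          vanish : ∀ a → B₁ ℕ.+ B₂ ℕ.< ∣ (λ x → f x + g x) · lookup a ∣ → h a ≈ 0#
          vanish a lt with B₁ ℕ.<? ∣ f · lookup a ∣ | B₂ ℕ.<? ∣ g · lookup a ∣
          ... | yes B₁< | _      = bounded₁ a B₁<
          ... | no  _   | yes B₂< = bounded₂ a B₂<
          ... | no  B₁≮ | no B₂≮ = contradiction lt (ℕₚ.≤⇒≯ (begin
            ∣ (λ x → f x + g x) · lookup a ∣       ≡⟨ cong ∣_∣ (·-+ˡ f g (lookup a)) ⟩
            ∣ f · lookup a + g · lookup a ∣       ≤⟨ ℤₚ.∣i+j∣≤∣i∣+∣j∣ (f · lookup a) (g · lookup a) ⟩
            ∣ f · lookup a ∣ ℕ.+ ∣ g · lookup a ∣ ≤⟨ ℕₚ.+-mono-≤ (ℕₚ.≮⇒≥ B₁≮) (ℕₚ.≮⇒≥ B₂≮) ⟩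
            B₁ ℕ.+ B₂                             ∎))
            where open ℕₚ.≤-Reasoning
      *-closed : ∀ c {f} → BoundedAlong h f → BoundedAlong h (λ x → c * f x)
      *-closed c {f} (B , bounded) = ∣ c ∣ ℕ.* B , vanish
        where
          vanish : ∀ a → ∣ c ∣ ℕ.* B ℕ.< ∣ (λ x → c * f x) · lookup a ∣ → h a ≈ 0#
          vanish a lt with B ℕ.<? ∣ f · lookup a ∣
          ... | yes B< = bounded a B<
          ... | no  B≮ = contradiction lt (ℕₚ.≤⇒≯ (begin
            ∣ (λ x → c * f x) · lookup a ∣   ≡⟨ cong ∣_∣ (·-*ˡ c f (lookup a)) ⟩
            ∣ c * f · lookup a ∣             ≡⟨ ℤₚ.abs-* c (f · lookup a) ⟩
            ∣ c ∣ ℕ.* ∣ f · lookup a ∣       ≤⟨ ℕₚ.*-monoʳ-≤ ∣ c ∣ (ℕₚ.≮⇒≥ B≮) ⟩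
            ∣ c ∣ ℕ.* B                      ∎))
            where open ℕₚ.≤-Reasoning

  BoundedAlong-Δ : ∀ {u v h f} → f · toℤᵛ u ≡ f · toℤᵛ v → BoundedAlong h f →
                   BoundedAlong (Δ (u , v) h) f
  BoundedAlong-Δ {u} {v} {h} {f} f·u≡f·v (B , bounded) = B ℕ.+ ∣ f · toℤᵛ u ∣ , vanish
    where
      vanish : ∀ a → B ℕ.+ ∣ f · toℤᵛ u ∣ ℕ.< ∣ f · lookup a ∣ → Δ (u , v) h a ≈ 0#
      vanish a lt = begin
        h (a −ᵥ u) ⊝ h (a −ᵥ v) ≈⟨ +-cong (bounded _ (shifted u refl)) (-‿cong (bounded _ (shifted v f·u≡f·v))) ⟩
        0# ⊝ 0#                 ≈⟨ -‿inverseʳ 0# ⟩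
        0#                      ∎
        where
          open ≈-Reasoning
          shifted : ∀ z → f · toℤᵛ u ≡ f · toℤᵛ z → B ℕ.< ∣ f · lookup (a −ᵥ z) ∣
          shifted z eq = subst (λ t → B ℕ.< ∣ t ∣) (sym (·-−ᵥ f a z))
            (+∣j∣<∣i∣⇒<∣i-j∣ B (f · lookup a) (f · toℤᵛ z)
              (subst (λ t → B ℕ.+ ∣ t ∣ ℕ.< ∣ f · lookup a ∣) eq lt))

  module _ {P : Vec ℤ n → Set} (P? : Decidable P) where

    restrict restrictᶜ : Series → Series
    restrict  h a = if does (P? a) then h a else 0#
    restrictᶜ h a = if does (P? a) then 0# else h a

    restrict-split : ∀ h → h ≐ λ a → restrict h a ⊕ restrictᶜ h a
    restrict-split h a with P? a
    ... | yes _ = ≈-sym (+-identityʳ (h a))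
    ... | no  _ = ≈-sym (+-identityˡ (h a))

    restrict-cong : ∀ {h a a′} → does (P? a) ≡ does (P? a′) → h a ≈ h a′ →
                    restrict h a ≈ restrict h a′ × restrictᶜ h a ≈ restrictᶜ h a′
    restrict-cong {h} {a} {a′} eq ha≈ha′ with P? a | P? a′
    ... | yes _ | yes _ = ha≈ha′ , ≈-refl
    ... | no  _ | no  _ = ≈-refl , ha≈ha′
    ... | yes _ | no  _ = contradiction eq λ ()
    ... | no  _ | yes _ = contradiction eq λ ()

    restrict-vanishes : ∀ h a → ¬ P a → restrict h a ≈ 0#
    restrict-vanishes h a ¬Pa rewrite dec-false (P? a) ¬Pa = ≈-refl

    restrictᶜ-vanishes : ∀ h a → (¬ P a → h a ≈ 0#) → restrictᶜ h a ≈ 0#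
    restrictᶜ-vanishes h a vanishes with P? a
    ... | yes _  = ≈-refl
    ... | no ¬Pa = vanishes ¬Pa

    BoundedAlong-restrict : ∀ {h f} → BoundedAlong h f → BoundedAlong (restrict h) f × BoundedAlong (restrictᶜ h) f
    BoundedAlong-restrict {h} (B , bounded) =
      (B , λ a lt → restrict-on a (bounded a lt)) , (B , λ a lt → restrictᶜ-on a (bounded a lt))
      where
        restrict-on : ∀ a → h a ≈ 0# → restrict h a ≈ 0#
        restrict-on a ha≈0 with P? a
        ... | yes _ = ha≈0
        ... | no  _ = ≈-refl
        restrictᶜ-on : ∀ a → h a ≈ 0# → restrictᶜ h a ≈ 0#
        restrictᶜ-on a ha≈0 = restrictᶜ-vanishes h a (λ _ → ha≈0)

  mulBinomial : Binomial n → Poly R n → Poly R n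
  mulBinomial p       []            = []
  mulBinomial (u , v) ((d , r) ∷ Q) = (d +ᴺ u , r) ∷ (d +ᴺ v , ⊖ r) ∷ mulBinomial (u , v) Q

  binomialProduct : List (Binomial n) → Poly R n
  binomialProduct []      = List.[ Vec.replicate n 0 , 1# ]
  binomialProduct (p ∷ W) = mulBinomial p (binomialProduct W)

  mulCoeff-mulBinomial : ∀ p Q F a → mulCoeff R (mulBinomial p Q) F a ≈ mulCoeff R Q (Δ p F) a
  mulCoeff-mulBinomial p       []            F a = ≈-refl
  mulCoeff-mulBinomial (u , v) ((d , r) ∷ Q) F a rewrite −ᵥ-+ᴺ a d u | −ᵥ-+ᴺ a d v = begin
    r ⊛ x ⊕ (⊖ r ⊛ y ⊕ rest)    ≈⟨ ≈-sym (+-assoc _ _ _) ⟩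
    r ⊛ x ⊕ ⊖ r ⊛ y ⊕ rest      ≈⟨ +-cong (+-cong ≈-refl (≈-sym (Ringₚ.-‿distribˡ-* r y)))
                                          (mulCoeff-mulBinomial (u , v) Q F a) ⟩
    r ⊛ x ⊝ r ⊛ y ⊕ rest′       ≈⟨ +-cong (≈-sym (Ringₚ.x[y-z]≈xy-xz r x y)) ≈-refl ⟩
    r ⊛ (x ⊝ y) ⊕ rest′         ∎
    where
      open ≈-Reasoning
      x = F ((a −ᵥ d) −ᵥ u)
      y = F ((a −ᵥ d) −ᵥ v)
      rest = mulCoeff R (mulBinomial (u , v) Q) F a
      rest′ = mulCoeff R Q (Δ (u , v) F) a

  mulCoeff-binomialProduct : ∀ W F a → mulCoeff R (binomialProduct W) F a ≈ Δ* W F a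
  mulCoeff-binomialProduct []      F a rewrite −ᵥ-zero a = ≈-trans (+-identityʳ _) (*-identityˡ _)
  mulCoeff-binomialProduct (p ∷ W) F a =
    ≈-trans (mulCoeff-mulBinomial p (binomialProduct W) F a) (mulCoeff-binomialProduct W (Δ p F) a)

  data LexMonic : Poly R n → Set c where
    lexMonic : ∀ e {Q} → All (λ t → e <ˡᵉˣ proj₁ t) Q → LexMonic ((e , 1#) ∷ Q)

  mulBinomial-above : ∀ {e u v} → u <ˡᵉˣ v → ∀ Q → All (λ t → e <ˡᵉˣ proj₁ t) Q →
                      All (λ t → e +ᴺ u <ˡᵉˣ proj₁ t) (mulBinomial (u , v) Q)
  mulBinomial-above u<v []            []          = []
  mulBinomial-above {u = u} u<v ((d , r) ∷ Q) (e<d ∷ e<Q) =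
    +ᴺ-monoˡ-<ˡᵉˣ u e<d ∷ <ˡᵉˣ.trans (+ᴺ-monoˡ-<ˡᵉˣ u e<d) (+ᴺ-monoʳ-<ˡᵉˣ d u<v) ∷
    mulBinomial-above u<v Q e<Q

  binomialProduct-lexMonic : ∀ {W} → All Ordered W → LexMonic (binomialProduct W)
  binomialProduct-lexMonic []                       = lexMonic (Vec.replicate n 0) []
  binomialProduct-lexMonic {(u , v) ∷ W} (u<v ∷ ordered) with binomialProduct W | binomialProduct-lexMonic ordered
  ... | _ | lexMonic e {Q} e<Q =
    lexMonic (e +ᴺ u) (+ᴺ-monoʳ-<ˡᵉˣ e u<v ∷ mulBinomial-above u<v Q e<Q)

  polyCoeff-above : ∀ {e} Q → All (λ t → e <ˡᵉˣ proj₁ t) Q → polyCoeff R {n} Q e ≈ 0#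
  polyCoeff-above []            []           = ≈-refl
  polyCoeff-above {e} ((d , r) ∷ Q) (e<d ∷ e<Q) with ≡-dec ℕ._≟_ d e
  ... | yes d≡e = contradiction (sym d≡e) (<ˡᵉˣ⇒≢ e<d)
  ... | no  _   = polyCoeff-above Q e<Q

  polyCoeff-leading : ∀ e Q → All (λ t → e <ˡᵉˣ proj₁ t) Q → polyCoeff R {n} ((e , 1#) ∷ Q) e ≈ 1#
  polyCoeff-leading e Q e<Q with ≡-dec ℕ._≟_ e e
  ... | yes _   = ≈-trans (+-cong ≈-refl (polyCoeff-above Q e<Q)) (+-identityʳ 1#)
  ... | no  e≢e = contradiction refl e≢e

  lexMonic-leading : ∀ {Q} → LexMonic Q → ∃ λ e → polyCoeff R {n} Q e ≈ 1#
  lexMonic-leading (lexMonic e {Q} e<Q) = e , polyCoeff-leading e Q e<Q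

  binomialProduct-nonZero : ¬ 1# ≈ 0# → ∀ {W} → All Ordered W → NonZeroPoly R (binomialProduct W)
  binomialProduct-nonZero 1≉0 ordered with lexMonic-leading (binomialProduct-lexMonic ordered)
  ... | e , coeff≈1 = e , λ coeff≈0 → 1≉0 (≈-trans (≈-sym coeff≈1) coeff≈0)

-- Series tame for the hyperplane arrangement of A

dotℤ-· : ∀ {n} (r a : Vec ℤ n) → dotℤ r a ≡ lookup r · lookup a
dotℤ-· []       []       = refl
dotℤ-· (x ∷ r) (y ∷ a) = cong (_+_ (x * y)) (dotℤ-· r a)

Agree-≤ᵇ : ∀ {β x y} → Agree (β , β) x y → (x ℤ.≤ᵇ β) ≡ (y ℤ.≤ᵇ β)
Agree-≤ᵇ equal = refl
Agree-≤ᵇ {β} {x} {y} (above β<x β<y) = trans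
  (dec-false (T? (x ℤ.≤ᵇ β)) (ℤₚ.<⇒≱ β<x ∘ ℤₚ.≤ᵇ⇒≤))
  (sym (dec-false (T? (y ℤ.≤ᵇ β)) (ℤₚ.<⇒≱ β<y ∘ ℤₚ.≤ᵇ⇒≤)))
Agree-≤ᵇ {β} {x} {y} (below x<β y<β) = trans
  (dec-true (T? (x ℤ.≤ᵇ β)) (ℤₚ.≤⇒≤ᵇ (ℤₚ.<⇒≤ x<β)))
  (sym (dec-true (T? (y ℤ.≤ᵇ β)) (ℤₚ.≤⇒≤ᵇ (ℤₚ.<⇒≤ y<β))))

Agree-≟ : ∀ {β x y} → Agree (β , β) x y → ⌊ x ℤ.≟ β ⌋ ≡ ⌊ y ℤ.≟ β ⌋
Agree-≟ {β} {x} {y} agree =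
  trans (isYes≗does (x ℤ.≟ β)) (trans (does-≟ agree) (sym (isYes≗does (y ℤ.≟ β))))
  where
    does-≟ : Agree (β , β) x y → does (x ℤ.≟ β) ≡ does (y ℤ.≟ β)
    does-≟ equal = refl
    does-≟ (above β<x β<y) = trans
      (dec-false (x ℤ.≟ β) (ℤₚ.<⇒≢ β<x ∘ sym)) (sym (dec-false (y ℤ.≟ β) (ℤₚ.<⇒≢ β<y ∘ sym)))
    does-≟ (below x<β y<β) = trans
      (dec-false (x ℤ.≟ β) (ℤₚ.<⇒≢ x<β)) (sym (dec-false (y ℤ.≟ β) (ℤₚ.<⇒≢ y<β)))

inP-tight-cong : ∀ {m n} (A : Mat m n) (b : Vec ℤ m) {a a′} →
  (∀ j → Agree (lookup b j , lookup b j) (dotℤ (lookup A j) a) (dotℤ (lookup A j) a′)) →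
  inP A b a ≡ inP A b a′ × tight A b a ≡ tight A b a′
inP-tight-cong []      []      agree = refl , refl
inP-tight-cong (r ∷ A) (β ∷ b) agree =
  cong₂ _∧_ (Agree-≤ᵇ (agree zero)) (proj₁ rest) , cong₂ _∷_ (Agree-≟ (agree zero)) (proj₂ rest)
  where rest = inP-tight-cong A b (agree ∘ suc)

module Arrangement {c ℓ} (R : CommutativeRing c ℓ) {m n} (A : Mat m n) where
  open CommutativeRing R using (_≈_; 0#; +-cong; -‿cong; -‿inverseʳ; reflexive)
    renaming (refl to ≈-refl; sym to ≈-sym; trans to ≈-trans)
  open Series R n

  rowForm : Fin m → Form n
  rowForm j = lookup (lookup A j)

  Agreeing : (Fin m → Interval) → Vec ℤ n → Vec ℤ n → Set
  Agreeing I a a′ = ∀ j → Agree (I j) (rowForm j · lookup a) (rowForm j · lookup a′)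

  Tame : (Fin m → Interval) → Series → Set ℓ
  Tame I h = ∀ a a′ → Agreeing I a a′ → h a ≈ h a′

  BoundedAlongForms : ∀ {k} → Echelon n k → Series → Set ℓ
  BoundedAlongForms E h = ∀ i → BoundedAlong h (Echelon.form E i)

  shiftIntervals : (Fin m → Interval) → Binomial n → Fin m → Interval
  shiftIntervals I (u , v) j = (I j ⊕ᴵ (rowForm j · toℤᵛ u)) ∪ᴵ (I j ⊕ᴵ (rowForm j · toℤᵛ v))

  Agree-−ᵥ : ∀ I j z a a′ →
             Agree (I ⊕ᴵ (rowForm j · toℤᵛ z)) (rowForm j · lookup a) (rowForm j · lookup a′) →
             Agree I (rowForm j · lookup (a −ᵥ z)) (rowForm j · lookup (a′ −ᵥ z))
  Agree-−ᵥ I j z a a′ agree =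
    subst₂ (Agree I) (sym (·-−ᵥ (rowForm j) a z)) (sym (·-−ᵥ (rowForm j) a′ z)) (Agree-shift I _ agree)

  Tame-Δ : ∀ {I h} p → Tame I h → Tame (shiftIntervals I p) (Δ p h)
  Tame-Δ {I} (u , v) tame a a′ agree = +-cong
    (tame (a −ᵥ u) (a′ −ᵥ u) λ j → Agree-−ᵥ (I j) j u a a′ (Agree-∪ˡ _ _ (agree j)))
    (-‿cong (tame (a −ᵥ v) (a′ −ᵥ v) λ j → Agree-−ᵥ (I j) j v a a′ (Agree-∪ʳ _ _ (agree j))))

  Relevant : Binomial n → Fin m → Set
  Relevant (u , v) j = rowForm j · toℤᵛ u ≢ rowForm j · toℤᵛ v

  relevant? : ∀ p → Decidable (Relevant p)
  relevant? (u , v) j = ¬? (rowForm j · toℤᵛ u ℤₚ.≟ rowForm j · toℤᵛ v)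

  Δ-vanishes : ∀ {I h} p → Tame I h → ∀ a →
               (∀ j → Relevant p j → Outside (shiftIntervals I p j) (rowForm j · lookup a)) → Δ p h a ≈ 0#
  Δ-vanishes {I} (u , v) tame a outside =
    ≈-trans (+-cong (tame (a −ᵥ u) (a −ᵥ v) agree) ≈-refl) (-‿inverseʳ _)
    where
      agree : Agreeing I (a −ᵥ u) (a −ᵥ v)
      agree j with rowForm j · toℤᵛ u ℤₚ.≟ rowForm j · toℤᵛ v
      ... | yes u≡v = subst (Agree (I j) _)
        (trans (·-−ᵥ (rowForm j) a u)
          (trans (cong (_-_ (rowForm j · lookup a)) u≡v) (sym (·-−ᵥ (rowForm j) a v))))
        equal
      ... | no  u≢v = subst₂ (Agree (I j)) (sym (·-−ᵥ (rowForm j) a u)) (sym (·-−ᵥ (rowForm j) a v))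
        (Outside-∪⇒Agree (I j) _ _ (outside j u≢v))

  inSlab? : ∀ I j → Decidable λ a → Inside I (rowForm j · lookup a)
  inSlab? I j a = inside? I (rowForm j · lookup a)

  Tame-restrict : ∀ {I h} j → Tame I h →
                  Tame I (restrict (inSlab? (I j) j) h) × Tame I (restrictᶜ (inSlab? (I j) j) h)
  Tame-restrict {I} {h} j tame =
    (λ a a′ → proj₁ ∘ restricted a a′) , (λ a a′ → proj₂ ∘ restricted a a′)
    where
      restricted : ∀ a a′ → Agreeing I a a′ →
        restrict (inSlab? (I j) j) h a ≈ restrict (inSlab? (I j) j) h a′ ×
        restrictᶜ (inSlab? (I j) j) h a ≈ restrictᶜ (inSlab? (I j) j) h a′
      restricted a a′ agree = restrict-cong (inSlab? (I j) j) {h} {a} {a′}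
        (Agree-inside? (I j) (agree j)) (tame a a′ agree)

  BoundedAlong-slab : ∀ I j h → BoundedAlong (restrict (inSlab? I j) h) (rowForm j)
  BoundedAlong-slab (lo , hi) j h = ∣ lo ∣ ℕ.⊔ ∣ hi ∣ , λ a lt →
    restrict-vanishes (inSlab? (lo , hi) j) h a (λ inside → ℕₚ.<⇒≱ lt (Inside⇒∣∣≤ lo hi inside))

  module _ {k} (E : Echelon n k) (I : Fin m → Interval) {Cut : Fin m → Set} (cut? : Decidable Cut)
           (absorb : ∀ j → Cut j → ∀ {g} → Tame I g → BoundedAlongForms E g → BoundedAlong g (rowForm j) →
                     Finitizable g)
           where

    finitizable-slices : ∀ J {g} → Tame I g → BoundedAlongForms E g →
      (∀ a → All (λ j → Cut j → Outside (I j) (rowForm j · lookup a)) J → g a ≈ 0#) → Finitizable g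
    finitizable-slices []      tame bounded vanishes = [] , [] , [] , λ a _ → vanishes a []
    finitizable-slices (j ∷ J) tame bounded vanishes with cut? j
    ... | no ¬cut = finitizable-slices J tame bounded λ a outside →
      vanishes a ((λ cut → contradiction cut ¬cut) ∷ outside)
    finitizable-slices (j ∷ J) {g} tame bounded vanishes | yes cut =
      finitizable-cong (λ a → ≈-sym (restrict-split slab g a)) (finitizable-+ inside-part outside-part)
      where
        slab = inSlab? (I j) j
        inside-part = absorb j cut (proj₁ (Tame-restrict j tame))
          (λ i → proj₁ (BoundedAlong-restrict slab {g} {Echelon.form E i} (bounded i)))
          (BoundedAlong-slab (I j) j g)
        outside-part = finitizable-slices J (proj₂ (Tame-restrict j tame))
          (λ i → proj₂ (BoundedAlong-restrict slab {g} {Echelon.form E i} (bounded i)))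
          λ a outside → restrictᶜ-vanishes slab g a λ ¬inside →
            vanishes a ((λ _ → ¬Inside⇒Outside (I j) ¬inside) ∷ outside)

  finitizable-full : ∀ {k} (E : Echelon n k) → (∀ col → ∃ λ i → Echelon.pivot E i ≡ col) →
                     ∀ {h} → BoundedAlongForms E h → Finitizable h
  finitizable-full E onto {h} bounded = finitizable-box B vanishes
    where
      B : Fin n → ℕ
      B col = proj₁ (bounded (proj₁ (onto col)))
      vanishes : ∀ a col → B col ℕ.< ∣ lookup a col ∣ → h a ≈ 0#
      vanishes a col B<∣a∣ = proj₂ (bounded i) a (ℕₚ.<-≤-trans B<∣a∣
        (subst (λ c → ∣ lookup a c ∣ ℕ.≤ ∣ Echelon.form E i · lookup a ∣) (proj₂ (onto col))
          (∣pivot-coordinate∣≤ E onto i (lookup a))))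
        where i = proj₁ (onto col)

  module _ {k} (E : Echelon n k) {col} (free : Free E col) where
    open Echelon E
    private
      w = kernel E col
      oriented = orient w col (λ w≡0 → D≢0 (trans (sym (kernel-free E free)) w≡0))
      p = proj₁ oriented

    finitizable-step : (∀ I (E′ : Echelon n (suc k)) {h} → Tame I h → BoundedAlongForms E′ h → Finitizable h) →
                       ∀ I {h} → Tame I h → BoundedAlongForms E h → Finitizable h
    finitizable-step recurse I {h} tame bounded = finitizable-Δ (proj₁ (proj₂ oriented))
      (finitizable-slices E I′ (relevant? p) absorb (List.allFin m) (Tame-Δ p tame) bounded-Δ
        λ a outside → Δ-vanishes p tame a λ j → All.lookup outside (∈-allFin j))
      where
        I′ = shiftIntervals I p
        balanced = proj₂ (proj₂ oriented)
        bounded-Δ : BoundedAlongForms E (Δ p h)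
        bounded-Δ i = BoundedAlong-Δ {h = h} {f = form i}
          (balanced (form i) (kernel-orthogonal E col i)) (bounded i)
        absorb : ∀ j → Relevant p j → ∀ {g} → Tame I′ g → BoundedAlongForms E g → BoundedAlong g (rowForm j) →
                 Finitizable g
        absorb j relevant tame-g bounded-g bounded-j = recurse I′ E′ tame-g
          (extend-closed E (rowForm j) w _ _ (BoundedAlong-isSubmodule _) bounded-j bounded-g)
          where E′ = extend E (rowForm j) w (kernel-orthogonal E col) (relevant ∘ balanced (rowForm j))

  finitizable : ∀ s {k} → k ℕ.+ s ≡ n → (E : Echelon n k) →
                ∀ I {h} → Tame I h → BoundedAlongForms E h → Finitizable h
  finitizable zero    {k} k+0≡n E I tame bounded =
    finitizable-full E (pivot-surjective E (trans (sym (ℕₚ.+-identityʳ k)) k+0≡n)) bounded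
  finitizable (suc s) {k} k+s≡n E I tame bounded with surjective⊎free E
  ... | inj₁ onto       = finitizable-full E onto bounded
  ... | inj₂ (_ , free) = finitizable-step E free
    (λ I′ E′ → finitizable s (trans (sym (ℕₚ.+-suc k s)) k+s≡n) E′ I′) I tame bounded

  trivialEchelon : Echelon n 0
  trivialEchelon = record { D = 1ℤ ; D≢0 = λ () ; pivot = λ () ; form = λ () ; form-pivot = λ () }

  tame⇒finitizable : ∀ I {h} → Tame I h → Finitizable h
  tame⇒finitizable I tame = finitizable n refl trivialEchelon I tame λ ()

  Scoeff-tame : ∀ b φ → Tame (λ j → lookup b j , lookup b j) (Scoeff R A b φ)
  Scoeff-tame b (φ , _) a a′ agree =
    reflexive (uncurry (cong₂ λ p t → if p then φ t else 0#) (inP-tight-cong A b agree′))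
    where
      agree′ = λ j →
        subst₂ (Agree _) (sym (dotℤ-· (lookup A j) a)) (sym (dotℤ-· (lookup A j) a′)) (agree j)

proposition3 : ∀ {c ℓ} (R : CommutativeRing c ℓ) →
    ¬ (CommutativeRing._≈_ R (CommutativeRing.1# R) (CommutativeRing.0# R)) →
    ∀ {m n} (A : Mat m n) (b : Vec ℤ m) (φ : FaceMap R A b) →
    ∃ λ (Q : Poly R n) → NonZeroPoly R Q ×
      ∃ λ (L : List (Vec ℤ n)) → ∀ (e : Vec ℤ n) → ¬ (e ∈ L) →
        CommutativeRing._≈_ R (mulCoeff R Q (Scoeff R A b φ) e) (CommutativeRing.0# R)
proposition3 R 1≉0 {n = n} A b φ
  with Arrangement.tame⇒finitizable R A _ (Arrangement.Scoeff-tame R A b φ)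
... | W , ordered , L , support =
  binomialProduct W , binomialProduct-nonZero 1≉0 ordered , L ,
  λ e e∉L → CommutativeRing.trans R (mulCoeff-binomialProduct W _ e) (support e e∉L)
  where open Series R n
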